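{- Let $M,N$ be computations of $\lambda_{\copyright}$. (1) For every sequence $\mathfrak s: M (\to^{\mathsf s}_{\sigma\beta_c})^* N$ there is a sequence $M (\to^{\mathsf w}_{\sigma\beta_c})^* L (\to^{\neg\mathsf w}_{\sigma\beta_c})^* N$ (for some $L$) all of whose steps are also $\to^{\mathsf s}_{\sigma\beta_c}$ steps, and which has the same number of $\beta_c$ steps as $\mathfrak s$. (2) For every sequence $\mathfrak s: M (\to^{\mathsf w}_{\sigma\beta_c})^* N$ there is a sequence $M (\to^{\mathsf w}_{\beta_c})^* L (\to^{\mathsf w}_{\sigma})^* N$ (for some $L$) with the same number of $\beta_c$ steps as $\mathfrak s$.
   Context: The computational core $\lambda_{\copyright}$ has values $V,W ::= x \mid \lambda x.M$ and computations $M,N,L ::= \,!V \mid VM$ ($x$ ranging over a countable set of variables, terms up to $\alpha$-renaming). Rules: $\beta_c$: $(\lambda x.M)(!V) \mapsto M\{V/x\}$; $\sigma$: $(\lambda y.N)((\lambda x.M)L) \mapsto (\lambda x.(\lambda y.N)M)L$ provided $x\notin \mathrm{fv}(N)$; $\sigma\beta_c=\sigma\cup\beta_c$. Contexts: $C ::= [\,] \mid\, !(\lambda x.C) \mid VC \mid (\lambda x.C)M$; surface contexts $S ::= [\,]\mid VS\mid(\lambda x.S)M$; weak contexts $W ::= [\,]\mid VW$. For a rule $\rho$: $\to^{\mathsf s}_\rho$ / $\to^{\mathsf w}_\rho$ is its closure under surface / weak contexts, and $\to^{\neg\mathsf w}_\rho$ is its closure under contexts that are not weak. A $\beta_c$ step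 is a step obtained from the rule $\beta_c$. $^*$ is reflexive–transitive closure. -}

module Defs where

open import Data.Nat using (ℕ; zero; suc; _<ᵇ_; _∸_; _+_)
open import Data.Bool using (if_then_else_)
open import Data.Product using (_×_)
open import Data.Unit using (⊤)
open import Data.Empty using (⊥)
open import Relation.Nullary using (¬_)
open import Relation.Binary.PropositionalEquality using (_≡_)

-- Terms of λ© with de Bruijn indices (terms up to α-renaming).
-- Values  V ::= x | λx.M      Computations  M ::= !V | V M
mutual
  data Val : Set where
    var : ℕ → Val
    lam : Comp → Val

  data Comp : Set where
    ret : Val → Comp
    app : Val → Comp → Comp

mutual
  shiftV : ℕ → Val → Val
  shiftV c (var x) = if x <ᵇ c then var x else var (suc x)
  shiftV c (lam M) = lam (shiftC (suc c) M)

  shiftC : ℕ → Comp → Comp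
  shiftC c (ret V)   = ret (shiftV c V)
  shiftC c (app V M) = app (shiftV c V) (shiftC c M)

substVar : ℕ → Val → ℕ → Val
substVar k V x = if x <ᵇ k then var x
                 else (if k <ᵇ x then var (x ∸ 1) else V)

mutual
  substV : ℕ → Val → Val → Val
  substV k V (var x) = substVar k V x
  substV k V (lam M) = lam (substC (suc k) (shiftV 0 V) M)

  substC : ℕ → Val → Comp → Comp
  substC k V (ret W)   = ret (substV k V W)
  substC k V (app W M) = app (substV k V W) (substC k V M)

-- M{V/x} where x is the variable bound by the enclosing λ (index 0)
_[_] : Comp → Val → Comp
M [ V ] = substC 0 V M

data Rule : Set where
  βc σ : Rule

-- Root reductions.
--  βc : (λx.M)(!V) ↦ M{V/x}
--  σ  : (λy.N)((λx.M)L) ↦ (λx.(λy.N)M)L   (x ∉ fv(N) is automatic in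
--       de Bruijn form: N is weakened past the new binder x)
data Root : Rule → Comp → Comp → Set where
  rβc : ∀ M V → Root βc (app (lam M) (ret V)) (M [ V ])
  rσ  : ∀ N M L →
        Root σ (app (lam N) (app (lam M) L))
               (app (lam (app (lam (shiftC 1 N)) M)) L)

data Ctx : Set where
  hole   : Ctx
  bangλ  : Ctx → Ctx
  appV   : Val → Ctx → Ctx
  lamApp : Ctx → Comp → Ctx

plug : Ctx → Comp → Comp
plug hole         P = P
plug (bangλ C)    P = ret (lam (plug C P))
plug (appV V C)   P = app V (plug C P)
plug (lamApp C M) P = app (lam (plug C P)) M

Surface : Ctx → Set
Surface hole         = ⊤
Surface (bangλ C)    = ⊥
Surface (appV V C)   = Surface C
Surface (lamApp C M) = Surface C

Weak : Ctx → Set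
Weak hole         = ⊤
Weak (bangλ C)    = ⊥
Weak (appV V C)   = Weak C
Weak (lamApp C M) = ⊥

-- Each step records its rule, so
-- sequences can be inspected (e.g. for counting βc steps).
data Steps (P : Rule → Ctx → Set) : Comp → Comp → Set where
  []  : ∀ {M} → Steps P M M
  _∷_ : ∀ {r C M₁ N₁ N} → (P r C × Root r M₁ N₁) →
        Steps P (plug C N₁) N → Steps P (plug C M₁) N

countβ : ∀ {P M N} → Steps P M N → ℕ
countβ [] = 0
countβ (_∷_ {βc} _ s) = suc (countβ s)
countβ (_∷_ {σ}  _ s) = countβ s

-- step predicates (rule σβc = σ ∪ βc, so any rule is allowed)
-- →ˢ_{σβc}
SurfStep : Rule → Ctx → Set
SurfStep _ C = Surface C
WeakStep : Rule → Ctx → Set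
WeakStep _ C = Weak C
SurfNonWeakStep : Rule → Ctx → Set
SurfNonWeakStep _ C = Surface C × ¬ Weak C
WeakβStep : Rule → Ctx → Set
WeakβStep r C = Weak C × r ≡ βc
WeakσStep : Rule → Ctx → Set
WeakσStep r C = Weak C × r ≡ σ

-- Both parts are postponement arguments. (1) A non-weak surface step rewrites the body of
-- some λx.M applied to an argument. A weak step that follows either acts elsewhere and
-- commutes with it, or is a root βc/σ step consuming that abstraction; then the root step can
-- be done first and the body step survives the substitution or the σ-rearrangement as a
-- surface step. Pushing each non-weak step rightwards through the weak steps after it is an
-- induction on their number. (2) A weak σ step followed by a weak βc step commutes, unless
-- the βc contracts the redex (λx.M)(!W) just exposed by σ, in which case the pair collapses
-- to one βc step in argument position. Swaps keep the rules of the steps they exchange, and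
-- the only collapse deletes a σ, so the number of βc steps is preserved.

module Submission where

open import Defs
open import Data.Bool using (if_then_else_)
open import Data.Nat using (ℕ; zero; suc; _+_; _<ᵇ_; _≤_; _<_; z≤n; s≤s)
open import Data.Nat.Properties
  using (<-cmp; _<?_; ≮⇒≥; ≤-refl; ≤-trans; <-≤-trans; m≤n⇒m≤1+n; m<n⇒m<1+n;
         +-assoc; +-commutativeSemigroup)
open import Algebra.Properties.CommutativeSemigroup +-commutativeSemigroup using (x∙yz≈y∙xz)
open import Data.Product using (_×_; Σ; ∃-syntax; _,_)
open import Data.Sum using (_⊎_; inj₁; inj₂)
open import Relation.Nullary using (yes; no)
open import Relation.Binary using (tri<; tri≈; tri>)
open import Relation.Binary.Construct.Closure.ReflexiveTransitive using (Star; ε; _◅_)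
open import Relation.Binary.PropositionalEquality using (_≡_; refl; sym; trans; cong; cong₂; subst)
open import Relation.Binary.PropositionalEquality.Properties using (module ≡-Reasoning)
open ≡-Reasoning

if-< : ∀ {A : Set} {m n} {a b : A} → m < n → (if m <ᵇ n then a else b) ≡ a
if-< {m = zero}  {suc n} _       = refl
if-< {m = suc m} {suc n} (s≤s p) = if-< p

if-≥ : ∀ {A : Set} {m n} {a b : A} → n ≤ m → (if m <ᵇ n then a else b) ≡ b
if-≥ {n = zero}          z≤n     = refl
if-≥ {m = suc m} {suc n} (s≤s p) = if-≥ p

shiftV-var-< : ∀ {c x} → x < c → shiftV c (var x) ≡ var x
shiftV-var-< = if-<

shiftV-var-≥ : ∀ {c x} → c ≤ x → shiftV c (var x) ≡ var (suc x)
shiftV-var-≥ = if-≥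

substV-var-< : ∀ {k x} V → x < k → substV k V (var x) ≡ var x
substV-var-< V = if-<

substV-var-≡ : ∀ k V → substV k V (var k) ≡ V
substV-var-≡ k V = trans (if-≥ (≤-refl {k})) (if-≥ (≤-refl {k}))

substV-var-> : ∀ {k y} V → k ≤ y → substV k V (var (suc y)) ≡ var y
substV-var-> V k≤y = trans (if-≥ (m≤n⇒m≤1+n k≤y)) (if-< (s≤s k≤y))

mutual
  shiftV-shiftV : ∀ k c → k ≤ c → ∀ T → shiftV (suc c) (shiftV k T) ≡ shiftV k (shiftV c T)
  shiftV-shiftV k c k≤c (var x) with x <? k | x <? c
  ... | yes x<k | _
    rewrite shiftV-var-< (<-≤-trans x<k k≤c) | shiftV-var-< x<k
          | shiftV-var-< (<-≤-trans x<k (m≤n⇒m≤1+n k≤c)) = refl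
  ... | no x≮k | yes x<c
    rewrite shiftV-var-< x<c | shiftV-var-≥ (≮⇒≥ x≮k) | shiftV-var-< (s≤s x<c) = refl
  ... | no x≮k | no x≮c
    rewrite shiftV-var-≥ (≮⇒≥ x≮c) | shiftV-var-≥ (≮⇒≥ x≮k)
          | shiftV-var-≥ (s≤s (≮⇒≥ x≮c))
          | shiftV-var-≥ (m≤n⇒m≤1+n (≮⇒≥ x≮k)) = refl
  shiftV-shiftV k c k≤c (lam M) = cong lam (shiftC-shiftC (suc k) (suc c) (s≤s k≤c) M)

  shiftC-shiftC : ∀ k c → k ≤ c → ∀ T → shiftC (suc c) (shiftC k T) ≡ shiftC k (shiftC c T)
  shiftC-shiftC k c k≤c (ret V)   = cong ret (shiftV-shiftV k c k≤c V)
  shiftC-shiftC k c k≤c (app V M) =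
    cong₂ app (shiftV-shiftV k c k≤c V) (shiftC-shiftC k c k≤c M)

mutual
  substV-shiftV : ∀ k V T → substV k V (shiftV k T) ≡ T
  substV-shiftV k V (var x) with x <? k
  ... | yes x<k rewrite shiftV-var-< x<k = substV-var-< V x<k
  ... | no x≮k  rewrite shiftV-var-≥ (≮⇒≥ x≮k) = substV-var-> V (≮⇒≥ x≮k)
  substV-shiftV k V (lam M) = cong lam (substC-shiftC (suc k) (shiftV 0 V) M)

  substC-shiftC : ∀ k V T → substC k V (shiftC k T) ≡ T
  substC-shiftC k V (ret W)   = cong ret (substV-shiftV k V W)
  substC-shiftC k V (app W M) = cong₂ app (substV-shiftV k V W) (substC-shiftC k V M)

mutual
  shiftV-substV-≤ : ∀ c k → c ≤ k → ∀ V T →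
                    shiftV c (substV k V T) ≡ substV (suc k) (shiftV c V) (shiftV c T)
  shiftV-substV-≤ c k c≤k V (var x) with <-cmp x k | x <? c
  ... | tri< x<k _ _ | yes x<c
    rewrite substV-var-< V x<k | shiftV-var-< x<c = sym (substV-var-< _ (m<n⇒m<1+n x<k))
  ... | tri< x<k _ _ | no x≮c
    rewrite substV-var-< V x<k | shiftV-var-≥ (≮⇒≥ x≮c) = sym (substV-var-< _ (s≤s x<k))
  shiftV-substV-≤ c k c≤k V (var x) | tri≈ _ refl _ | _
    rewrite substV-var-≡ x V | shiftV-var-≥ c≤k = sym (substV-var-≡ (suc x) _)
  shiftV-substV-≤ c k c≤k V (var (suc y)) | tri> _ _ (s≤s k≤y) | _
    rewrite substV-var-> V k≤y | shiftV-var-≥ (≤-trans c≤k k≤y)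
          | shiftV-var-≥ (m≤n⇒m≤1+n (≤-trans c≤k k≤y)) = sym (substV-var-> _ (s≤s k≤y))
  shiftV-substV-≤ c k c≤k V (lam M) =
    cong lam (trans (shiftC-substC-≤ (suc c) (suc k) (s≤s c≤k) (shiftV 0 V) M)
                    (cong (λ W → substC (suc (suc k)) W (shiftC (suc c) M)) (shiftV-shiftV 0 c z≤n V)))

  shiftC-substC-≤ : ∀ c k → c ≤ k → ∀ V T →
                    shiftC c (substC k V T) ≡ substC (suc k) (shiftV c V) (shiftC c T)
  shiftC-substC-≤ c k c≤k V (ret W)   = cong ret (shiftV-substV-≤ c k c≤k V W)
  shiftC-substC-≤ c k c≤k V (app W M) =
    cong₂ app (shiftV-substV-≤ c k c≤k V W) (shiftC-substC-≤ c k c≤k V M)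

mutual
  shiftV-substV-≥ : ∀ k c → k ≤ c → ∀ V T →
                    shiftV c (substV k V T) ≡ substV k (shiftV c V) (shiftV (suc c) T)
  shiftV-substV-≥ k c k≤c V (var x) with <-cmp x k
  ... | tri< x<k _ _
    rewrite substV-var-< V x<k | shiftV-var-< (<-≤-trans x<k k≤c)
          | shiftV-var-< (<-≤-trans x<k (m≤n⇒m≤1+n k≤c)) = sym (substV-var-< _ x<k)
  shiftV-substV-≥ k c k≤c V (var x) | tri≈ _ refl _
    rewrite substV-var-≡ x V | shiftV-var-< (s≤s k≤c) = sym (substV-var-≡ x _)
  shiftV-substV-≥ k c k≤c V (var (suc y)) | tri> _ _ (s≤s k≤y) with y <? c
  ... | yes y<c
    rewrite substV-var-> V k≤y | shiftV-var-< y<c | shiftV-var-< (s≤s y<c) = sym (substV-var-> _ k≤y)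
  ... | no y≮c
    rewrite substV-var-> V k≤y | shiftV-var-≥ (≮⇒≥ y≮c) | shiftV-var-≥ (s≤s (≮⇒≥ y≮c)) =
      sym (substV-var-> _ (m≤n⇒m≤1+n k≤y))
  shiftV-substV-≥ k c k≤c V (lam M) =
    cong lam (trans (shiftC-substC-≥ (suc k) (suc c) (s≤s k≤c) (shiftV 0 V) M)
                    (cong (λ W → substC (suc k) W (shiftC (suc (suc c)) M)) (shiftV-shiftV 0 c z≤n V)))

  shiftC-substC-≥ : ∀ k c → k ≤ c → ∀ V T →
                    shiftC c (substC k V T) ≡ substC k (shiftV c V) (shiftC (suc c) T)
  shiftC-substC-≥ k c k≤c V (ret W)   = cong ret (shiftV-substV-≥ k c k≤c V W)
  shiftC-substC-≥ k c k≤c V (app W M) =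
    cong₂ app (shiftV-substV-≥ k c k≤c V W) (shiftC-substC-≥ k c k≤c V M)

mutual
  substV-substV : ∀ j k → j ≤ k → ∀ V U T →
                  substV k V (substV j U T) ≡ substV j (substV k V U) (substV (suc k) (shiftV j V) T)
  substV-substV j k j≤k V U (var x) with <-cmp x j
  ... | tri< x<j _ _
    rewrite substV-var-< U x<j | substV-var-< V (<-≤-trans x<j j≤k)
          | substV-var-< (shiftV j V) (<-≤-trans x<j (m≤n⇒m≤1+n j≤k)) = sym (substV-var-< _ x<j)
  substV-substV j k j≤k V U (var x) | tri≈ _ refl _
    rewrite substV-var-≡ x U | substV-var-< (shiftV x V) (s≤s j≤k) = sym (substV-var-≡ x _)
  substV-substV j k j≤k V U (var (suc y)) | tri> _ _ (s≤s j≤y) with <-cmp y k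
  ... | tri< y<k _ _
    rewrite substV-var-> U j≤y | substV-var-< V y<k | substV-var-< (shiftV j V) (s≤s y<k) =
      sym (substV-var-> _ j≤y)
  substV-substV j k j≤k V U (var (suc y)) | tri> _ _ (s≤s j≤y) | tri≈ _ refl _
    = begin
        substV y V (substV j U (var (suc y)))  ≡⟨ cong (substV y V) (substV-var-> U j≤y) ⟩
        substV y V (var y)                     ≡⟨ substV-var-≡ y V ⟩
        V                                      ≡⟨ substV-shiftV j (substV y V U) V ⟨
        substV j (substV y V U) (shiftV j V)   ≡⟨ cong (substV j _) (substV-var-≡ (suc y) (shiftV j V)) ⟨
        substV j (substV y V U) (substV (suc y) (shiftV j V) (var (suc y)))  ∎
  substV-substV j k j≤k V U (var (suc (suc z))) | tri> _ _ (s≤s j≤y) | tri> _ _ (s≤s k≤z)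
    rewrite substV-var-> U j≤y | substV-var-> V k≤z | substV-var-> (shiftV j V) (s≤s k≤z) =
      sym (substV-var-> _ (≤-trans j≤k k≤z))
  substV-substV j k j≤k V U (lam M) =
    cong lam (trans (substC-substC (suc j) (suc k) (s≤s j≤k) (shiftV 0 V) (shiftV 0 U) M)
                    (cong₂ (λ W X → substC (suc j) W (substC (suc (suc k)) X M))
                           (sym (shiftV-substV-≤ 0 k z≤n V U)) (shiftV-shiftV 0 j z≤n V)))

  substC-substC : ∀ j k → j ≤ k → ∀ V U T →
                  substC k V (substC j U T) ≡ substC j (substV k V U) (substC (suc k) (shiftV j V) T)
  substC-substC j k j≤k V U (ret W)   = cong ret (substV-substV j k j≤k V U W)
  substC-substC j k j≤k V U (app W M) =
    cong₂ app (substV-substV j k j≤k V U W) (substC-substC j k j≤k V U M)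

Root-shift : ∀ {r M N} c → Root r M N → Root r (shiftC c M) (shiftC c N)
Root-shift c (rβc M V) rewrite shiftC-substC-≥ 0 c z≤n V M = rβc _ _
Root-shift c (rσ N M L) rewrite shiftC-shiftC 1 (suc c) (s≤s z≤n) N = rσ _ _ _

Root-subst : ∀ {r M N} k V → Root r M N → Root r (substC k V M) (substC k V N)
Root-subst k V (rβc M U) rewrite substC-substC 0 k z≤n V U M = rβc _ _
Root-subst k V (rσ N M L)
  rewrite sym (shiftV-shiftV 0 0 z≤n V)
        | sym (shiftC-substC-≤ 1 (suc k) (s≤s z≤n) (shiftV 0 V) N) = rσ _ _ _

Labelled : Set₁
Labelled = Rule → Comp → Comp → Set

variable
  P Q : Rule → Ctx → Set
  R S : Labelled

infix 4 _⊆_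
_⊆_ : Labelled → Labelled → Set
R ⊆ S = ∀ {r M N} → R r M N → S r M N

infixl 5 _↾_
_↾_ : Labelled → Rule → Labelled
(R ↾ ρ) r M N = r ≡ ρ × R r M N

data SurfaceRed (r : Rule) : Comp → Comp → Set where
  root : ∀ {M N} → Root r M N → SurfaceRed r M N
  arg  : ∀ {M N} V → SurfaceRed r M N → SurfaceRed r (app V M) (app V N)
  body : ∀ {M N} L → SurfaceRed r M N → SurfaceRed r (app (lam M) L) (app (lam N) L)

data WeakRed (r : Rule) : Comp → Comp → Set where
  root : ∀ {M N} → Root r M N → WeakRed r M N
  arg  : ∀ {M N} V → WeakRed r M N → WeakRed r (app V M) (app V N)

data NonWeakRed (r : Rule) : Comp → Comp → Set where
  arg  : ∀ {M N} V → NonWeakRed r M N → NonWeakRed r (app V M) (app V N)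
  body : ∀ {M N} L → SurfaceRed r M N → NonWeakRed r (app (lam M) L) (app (lam N) L)

SurfaceRed-shift : ∀ {r M N} c → SurfaceRed r M N → SurfaceRed r (shiftC c M) (shiftC c N)
SurfaceRed-shift c (root ρ)   = root (Root-shift c ρ)
SurfaceRed-shift c (arg V s)  = arg (shiftV c V) (SurfaceRed-shift c s)
SurfaceRed-shift c (body L s) = body (shiftC c L) (SurfaceRed-shift (suc c) s)

SurfaceRed-subst : ∀ {r M N} k V → SurfaceRed r M N → SurfaceRed r (substC k V M) (substC k V N)
SurfaceRed-subst k V (root ρ)   = root (Root-subst k V ρ)
SurfaceRed-subst k V (arg W s)  = arg (substV k V W) (SurfaceRed-subst k V s)
SurfaceRed-subst k V (body L s) = body (substC k V L) (SurfaceRed-subst (suc k) (shiftV 0 V) s)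

NonWeakRed⇒SurfaceRed : NonWeakRed ⊆ SurfaceRed
NonWeakRed⇒SurfaceRed (arg V n)  = arg V (NonWeakRed⇒SurfaceRed n)
NonWeakRed⇒SurfaceRed (body L s) = body L s

SurfaceRed⇒Weak⊎NonWeak : ∀ {r M N} → SurfaceRed r M N → WeakRed r M N ⊎ NonWeakRed r M N
SurfaceRed⇒Weak⊎NonWeak (root ρ) = inj₁ (root ρ)
SurfaceRed⇒Weak⊎NonWeak (arg V s) with SurfaceRed⇒Weak⊎NonWeak s
... | inj₁ w = inj₁ (arg V w)
... | inj₂ n = inj₂ (arg V n)
SurfaceRed⇒Weak⊎NonWeak (body L s) = inj₂ (body L s)

nonWeak-weak-swap : ∀ {r₁ r₂ A B D} → NonWeakRed r₁ A B → WeakRed r₂ B D →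
                    ∃[ B′ ] WeakRed r₂ A B′ × SurfaceRed r₁ B′ D
nonWeak-weak-swap (body L s) (root (rβc _ W))   = _ , root (rβc _ W) , SurfaceRed-subst 0 W s
nonWeak-weak-swap (body L s) (root (rσ _ M L′)) =
  _ , root (rσ _ M L′) , body L′ (body M (SurfaceRed-shift 1 s))
nonWeak-weak-swap (body L s) (arg _ w)          = _ , arg _ w , body _ s
nonWeak-weak-swap (arg _ (body L s)) (root (rσ N _ _)) = _ , root (rσ N _ L) , body L (arg _ s)
nonWeak-weak-swap (arg _ (arg _ n)) (root (rσ N M _))  =
  _ , root (rσ N M _) , arg _ (NonWeakRed⇒SurfaceRed n)
nonWeak-weak-swap (arg V n) (arg _ w) with nonWeak-weak-swap n w
... | _ , w′ , s′ = _ , arg V w′ , arg V s′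

σ-βc-swap : ∀ {A B D} → WeakRed σ A B → WeakRed βc B D →
            WeakRed βc A D ⊎ ∃[ B′ ] WeakRed βc A B′ × WeakRed σ B′ D
-- (λy.N)((λx.M)(!W)) →σ (λx.(λy.N)M)(!W) →βc (λy.N)(M{W/x})
σ-βc-swap (root (rσ N M _)) (root (rβc _ W))
  rewrite substC-shiftC 1 (shiftV 0 W) N = inj₁ (arg (lam N) (root (rβc M W)))
σ-βc-swap (root (rσ N M _)) (arg _ w) = inj₂ (_ , arg _ (arg _ w) , root (rσ N M _))
σ-βc-swap (arg V (root ())) (root (rβc _ _))
σ-βc-swap (arg V s) (arg _ w) with σ-βc-swap s w
... | inj₁ w′            = inj₁ (arg V w′)
... | inj₂ (_ , w′ , s′) = inj₂ (_ , arg V w′ , arg V s′)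

Seq : Labelled → Comp → Comp → Set
Seq R = Star (λ M N → ∃[ r ] R r M N)

βweight : Rule → ℕ
βweight βc = 1
βweight σ  = 0

βcount : ∀ {M N} → Seq R M N → ℕ
βcount ε             = 0
βcount ((r , _) ◅ s) = βweight r + βcount s

Split : Labelled → Labelled → Comp → Comp → ℕ → Set
Split R S M N n =
  ∃[ L ] Σ (Seq R M L) λ s₁ → Σ (Seq S L N) λ s₂ → βcount s₁ + βcount s₂ ≡ n

infixr 5 _◅ˡ_
_◅ˡ_ : ∀ {r M M′ N n} → R r M M′ → Split R S M′ N n → Split R S M N (βweight r + n)
_◅ˡ_ {r = r} x (L , s₁ , s₂ , e) =
  L , (r , x) ◅ s₁ , s₂ , trans (+-assoc (βweight r) _ _) (cong (βweight r +_) e)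

postpone-nonWeak : ∀ {r A B L N} → NonWeakRed r A B →
                   (ws : Seq WeakRed B L) (ns : Seq NonWeakRed L N) →
                   Split WeakRed NonWeakRed A N (βweight r + (βcount ws + βcount ns))
postpone-nonWeak n ε ns = _ , ε , (_ , n) ◅ ns , refl
postpone-nonWeak {r} n ((r₂ , w) ◅ ws) ns with nonWeak-weak-swap n w
... | _ , w′ , s′ = subst (Split WeakRed NonWeakRed _ _) count (w′ ◅ˡ rest)
  where
  count : βweight r₂ + (βweight r + (βcount ws + βcount ns)) ≡
          βweight r + (βcount ((r₂ , w) ◅ ws) + βcount ns)
  count = trans (x∙yz≈y∙xz (βweight r₂) (βweight r) _)
                (cong (βweight r +_) (sym (+-assoc (βweight r₂) _ _)))
  rest : Split WeakRed NonWeakRed _ _ (βweight r + (βcount ws + βcount ns))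
  rest with SurfaceRed⇒Weak⊎NonWeak s′
  ... | inj₁ w″ = w″ ◅ˡ (_ , ws , ns , refl)
  ... | inj₂ n″ = postpone-nonWeak n″ ws ns

surface-factorisation : ∀ {M N} (s : Seq SurfaceRed M N) →
                        Split WeakRed NonWeakRed M N (βcount s)
surface-factorisation ε = _ , ε , ε , refl
surface-factorisation ((r , x) ◅ s) with surface-factorisation s | SurfaceRed⇒Weak⊎NonWeak x
... | split            | inj₁ w = w ◅ˡ split
... | _ , ws , ns , e  | inj₂ n =
  subst (Split WeakRed NonWeakRed _ _) (cong (βweight r +_) e) (postpone-nonWeak n ws ns)

postpone-σ : ∀ {A B L N} → WeakRed σ A B →
             (bs : Seq (WeakRed ↾ βc) B L) (ss : Seq (WeakRed ↾ σ) L N) →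
             Split (WeakRed ↾ βc) (WeakRed ↾ σ) A N (βcount bs + βcount ss)
postpone-σ s ε ss = _ , ε , (σ , refl , s) ◅ ss , refl
postpone-σ s ((βc , refl , b) ◅ bs) ss with σ-βc-swap s b
... | inj₁ b′            = (refl , b′) ◅ˡ (_ , bs , ss , refl)
... | inj₂ (_ , b′ , s′) = (refl , b′) ◅ˡ postpone-σ s′ bs ss

weak-factorisation : ∀ {M N} (s : Seq WeakRed M N) →
                     Split (WeakRed ↾ βc) (WeakRed ↾ σ) M N (βcount s)
weak-factorisation ε = _ , ε , ε , refl
weak-factorisation ((βc , x) ◅ s) = (refl , x) ◅ˡ weak-factorisation s
weak-factorisation ((σ , x) ◅ s) with weak-factorisation s
... | _ , bs , ss , e = subst (Split _ _ _ _) e (postpone-σ x bs ss)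

data InContext (P : Rule → Ctx → Set) (r : Rule) : Comp → Comp → Set where
  plugged : ∀ {C M N} → P r C → Root r M N → InContext P r (plug C M) (plug C N)

fromSteps : InContext P ⊆ R → ∀ {M N} → Steps P M N → Seq R M N
fromSteps f []            = ε
fromSteps f ((p , ρ) ∷ s) = (_ , f (plugged p ρ)) ◅ fromSteps f s

βcount-fromSteps : (f : InContext P ⊆ R) → ∀ {M N} (s : Steps P M N) →
                   βcount (fromSteps f s) ≡ countβ s
βcount-fromSteps f []             = refl
βcount-fromSteps f (_∷_ {βc} _ s) = cong suc (βcount-fromSteps f s)
βcount-fromSteps f (_∷_ {σ} _ s)  = βcount-fromSteps f s

toSteps : R ⊆ InContext P → ∀ {M N} → Seq R M N → Steps P M N
toSteps f ε             = []
toSteps f ((_ , x) ◅ s) with f x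
... | plugged p ρ = (p , ρ) ∷ toSteps f s

countβ-toSteps : (f : R ⊆ InContext P) → ∀ {M N} (s : Seq R M N) →
                 countβ (toSteps f s) ≡ βcount s
countβ-toSteps f ε = refl
countβ-toSteps f ((r , x) ◅ s) with f x
countβ-toSteps f ((βc , x) ◅ s) | plugged _ _ = cong suc (countβ-toSteps f s)
countβ-toSteps f ((σ , x) ◅ s)  | plugged _ _ = countβ-toSteps f s

Steps⇒Split : ∀ {R₁ R₂} (f : InContext P ⊆ R) →
              (∀ {M N} (t : Seq R M N) → Split R₁ R₂ M N (βcount t)) →
              ∀ {M N} (s : Steps P M N) → Split R₁ R₂ M N (countβ s)
Steps⇒Split f factorise s =
  subst (Split _ _ _ _) (βcount-fromSteps f s) (factorise (fromSteps f s))

Split⇒Steps : ∀ {M N n} →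
              R ⊆ InContext P → S ⊆ InContext Q →
              Split R S M N n →
              ∃[ L ] Σ (Steps P M L) λ s₁ → Σ (Steps Q L N) λ s₂ → countβ s₁ + countβ s₂ ≡ n
Split⇒Steps f g (L , s₁ , s₂ , e) =
  L , toSteps f s₁ , toSteps g s₂ ,
  trans (cong₂ _+_ (countβ-toSteps f s₁) (countβ-toSteps g s₂)) e

InContext⇒SurfaceRed : InContext SurfStep ⊆ SurfaceRed
InContext⇒SurfaceRed (plugged {hole} _ ρ)       = root ρ
InContext⇒SurfaceRed (plugged {appV V C} p ρ)   = arg V (InContext⇒SurfaceRed (plugged {C = C} p ρ))
InContext⇒SurfaceRed (plugged {lamApp C L} p ρ) = body L (InContext⇒SurfaceRed (plugged {C = C} p ρ))

SurfaceRed⇒InContext : SurfaceRed ⊆ InContext SurfStep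
SurfaceRed⇒InContext (root ρ) = plugged {C = hole} _ ρ
SurfaceRed⇒InContext (arg V s) with SurfaceRed⇒InContext s
... | plugged p ρ = plugged {C = appV V _} p ρ
SurfaceRed⇒InContext (body L s) with SurfaceRed⇒InContext s
... | plugged p ρ = plugged {C = lamApp _ L} p ρ

InContext⇒WeakRed : InContext WeakStep ⊆ WeakRed
InContext⇒WeakRed (plugged {hole} _ ρ)     = root ρ
InContext⇒WeakRed (plugged {appV V C} p ρ) = arg V (InContext⇒WeakRed (plugged {C = C} p ρ))

WeakRed⇒InContext : WeakRed ⊆ InContext WeakStep
WeakRed⇒InContext (root ρ) = plugged {C = hole} _ ρ
WeakRed⇒InContext (arg V w) with WeakRed⇒InContext w
... | plugged p ρ = plugged {C = appV V _} p ρ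

NonWeakRed⇒InContext : NonWeakRed ⊆ InContext SurfNonWeakStep
NonWeakRed⇒InContext (arg V n) with NonWeakRed⇒InContext n
... | plugged p ρ = plugged {C = appV V _} p ρ
NonWeakRed⇒InContext (body L s) with SurfaceRed⇒InContext s
... | plugged p ρ = plugged {C = lamApp _ L} (p , λ ()) ρ

↾⇒InContext : ∀ {ρ} → R ⊆ InContext P → R ↾ ρ ⊆ InContext (λ r C → P r C × r ≡ ρ)
↾⇒InContext f (refl , x) with f x
... | plugged p ρ = plugged (p , refl) ρ

mainTheorem5 :
    ((M N : Comp) → (s : Steps SurfStep M N) →
       ∃[ L ] Σ (Steps WeakStep M L) λ s₁ → Σ (Steps SurfNonWeakStep L N) λ s₂ →
         countβ s₁ + countβ s₂ ≡ countβ s)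
    × ((M N : Comp) → (s : Steps WeakStep M N) →
       ∃[ L ] Σ (Steps WeakβStep M L) λ s₁ → Σ (Steps WeakσStep L N) λ s₂ →
         countβ s₁ + countβ s₂ ≡ countβ s)
mainTheorem5 =
  (λ M N s → Split⇒Steps WeakRed⇒InContext NonWeakRed⇒InContext
               (Steps⇒Split InContext⇒SurfaceRed surface-factorisation s)) ,
  (λ M N s → Split⇒Steps (↾⇒InContext WeakRed⇒InContext) (↾⇒InContext WeakRed⇒InContext)
               (Steps⇒Split InContext⇒WeakRed weak-factorisation s))
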